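{- For a bimodal formula $\varphi$, let $\mathrm{main}$ be the alphabetically first propositional variable that is not a subformula of $\varphi$. Define $T$ recursively by $T(A):=A$ for propositional variables $A$, $T(\neg\psi):=\neg T(\psi)$, $T((\psi_1\wedge\psi_2)):=(T(\psi_1)\wedge T(\psi_2))$, $T(K\psi):=K\neg(\mathrm{main}\wedge\neg T(\psi))$, $T(\Box\psi):=\Box\neg(\mathrm{main}\wedge\neg T(\psi))$; let \[\mathit{persistent}_{\mathrm{main}}:=\bigwedge_{A\in AT\cap\mathrm{sf}(\varphi)}K\bigl(\Box(\mathrm{main}\to A)\vee\Box(\mathrm{main}\to\neg A)\bigr),\] and \[\widehat T(\varphi):=\mathrm{main}\wedge K\Box(\neg\mathrm{main}\to\Box\neg\mathrm{main})\wedge\mathit{persistent}_{\mathrm{main}}\wedge T(\varphi).\] Then for every bimodal formula $\varphi$: $\varphi$ is $\mathrm{SSL}$-satisfiable if and only if $\widehat T(\varphi)$ is $\mathrm{S4\times S5}$-satisfiable.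
   Context: Bimodal formulas are built from a countable set $AT$ of propositional variables using $\neg$, $\wedge$, $K$, $\Box$; $\mathrm{sf}(\varphi)$ is the set of subformulas of $\varphi$; $\to,\vee$ are the usual abbreviations. $K\psi$ (resp. $\Box\psi$) holds at $p$ iff $\psi$ holds at all $\stackrel{L}{\to}$- (resp. $\stackrel{\Diamond}{\to}$-)successors of $p$. A cross axiom model is $(W,\stackrel{\Diamond}{\to},\stackrel{L}{\to},\sigma)$ with $\stackrel{L}{\to}$ an equivalence relation, $\stackrel{\Diamond}{\to}$ reflexive and transitive, left commutativity (if $p\stackrel{\Diamond}{\to}q\stackrel{L}{\to}r$ then $p\stackrel{L}{\to}s\stackrel{\Diamond}{\to}r$ for some $s$), and every propositional variable persistent (if $p\stackrel{\Diamond}{\to}q$ then $p\in\sigma(A)\iff q\in\sigma(A)$); a formula is SSL-satisfiable iff it holds at some point of some cross axiom model. An $\mathrm{S4\times S5}$-commutator model has $\stackrel{L}{\to}$ an equivalence relation, $\stackrel{\Diamond}{\to}$ reflexive and transitive, left commutativity and right commutativity (if $p\stackrel{L}{\to}q\stackrel{\Diamond}{\to}r$ then $p\stackrel{\Diamond}{\to}s\stackrel{L}{\to}r$ for some $s$); a formula is $\mathrm{S4\times S5}$-satisfiable iff it holds at some point of such a model (equivalently of an $\mathrm{S4\times S5}$-product model). -}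

module Defs where

open import Data.Nat using (ℕ; zero; suc)
open import Data.Nat.Properties using (_≟_)
open import Data.Bool using (Bool; true; false; if_then_else_)
open import Data.List using (List; []; _∷_; length)
open import Data.Bool.ListAction using (any)
open import Data.List.NonEmpty as L⁺ using (List⁺; _∷_; _⁺++⁺_; toList; foldr₁; map)
open import Data.Product using (Σ; _×_; _,_)
open import Data.Empty using (⊥)
open import Relation.Nullary using (¬_; does)
open import Relation.Binary using (IsEquivalence; Reflexive; Transitive)

-- Propositional variables: AT = ℕ, "alphabetical" order = the order of ℕ.
data Fm : Set where
  var : ℕ → Fm
  ~_  : Fm → Fm
  _∧_ : Fm → Fm → Fm
  K   : Fm → Fm
  □   : Fm → Fm

infixr 6 _∧_
infixr 5 _⇒_ _∨_

_⇒_ : Fm → Fm → Fm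
a ⇒ b = ~ (a ∧ ~ b)

_∨_ : Fm → Fm → Fm
a ∨ b = ~ (~ a ∧ ~ b)

-- the propositional variables occurring in φ, i.e. AT ∩ sf(φ) (as a nonempty list, possibly with repetitions)
vars : Fm → List⁺ ℕ
vars (var n) = n ∷ []
vars (~ ψ) = vars ψ
vars (ψ₁ ∧ ψ₂) = vars ψ₁ ⁺++⁺ vars ψ₂
vars (K ψ) = vars ψ
vars (□ ψ) = vars ψ

_∈ᵇ_ : ℕ → List ℕ → Bool
n ∈ᵇ l = any (λ m → does (n ≟ m)) l

search : List ℕ → ℕ → ℕ → ℕ
search l zero k = k
search l (suc fuel) k = if k ∈ᵇ l then search l fuel (suc k) else k

-- least natural number not in l (it lies in 0 .. length l, so fuel length l suffices)
leastNotIn : List ℕ → ℕ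
leastNotIn l = search l (length l) 0

mainVar : Fm → ℕ
mainVar φ = leastNotIn (toList (vars φ))

T : ℕ → Fm → Fm
T m (var A) = var A
T m (~ ψ) = ~ T m ψ
T m (ψ₁ ∧ ψ₂) = T m ψ₁ ∧ T m ψ₂
T m (K ψ) = K (~ (var m ∧ ~ T m ψ))
T m (□ ψ) = □ (~ (var m ∧ ~ T m ψ))

bigAnd : List⁺ Fm → Fm
bigAnd = foldr₁ _∧_

persistentMain : Fm → Fm
persistentMain φ =
  bigAnd (map (λ A → K (□ (var m ⇒ var A) ∨ □ (var m ⇒ ~ var A))) (vars φ))
  where m = mainVar φ

That : Fm → Fm
That φ = var m ∧ K (□ (~ var m ⇒ □ (~ var m))) ∧ persistentMain φ ∧ T m φ
  where m = mainVar φ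

record Model : Set₁ where
  field
    W   : Set
    _⇝◇_ : W → W → Set
    _⇝L_ : W → W → Set
    σ   : ℕ → W → Set

module _ (M : Model) where
  open Model M
  _⊨_ : W → Fm → Set
  p ⊨ var A = σ A p
  p ⊨ (~ ψ) = ¬ (p ⊨ ψ)
  p ⊨ (ψ₁ ∧ ψ₂) = (p ⊨ ψ₁) × (p ⊨ ψ₂)
  p ⊨ K ψ = ∀ q → p ⇝L q → q ⊨ ψ
  p ⊨ □ ψ = ∀ q → p ⇝◇ q → q ⊨ ψ

  LeftComm : Set
  LeftComm = ∀ p q r → p ⇝◇ q → q ⇝L r → Σ W (λ s → (p ⇝L s) × (s ⇝◇ r))

  RightComm : Set
  RightComm = ∀ p q r → p ⇝L q → q ⇝◇ r → Σ W (λ s → (p ⇝◇ s) × (s ⇝L r))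

  Persistent : Set
  Persistent = ∀ A p q → p ⇝◇ q → (σ A p → σ A q) × (σ A q → σ A p)

  record IsCrossAxiomModel : Set where
    field
      L-equiv : IsEquivalence _⇝L_
      ◇-refl  : Reflexive _⇝◇_
      ◇-trans : Transitive _⇝◇_
      leftComm : LeftComm
      persistent : Persistent

  record IsS4S5Commutator : Set where
    field
      L-equiv : IsEquivalence _⇝L_
      ◇-refl  : Reflexive _⇝◇_
      ◇-trans : Transitive _⇝◇_
      leftComm : LeftComm
      rightComm : RightComm

SSL-Sat : Fm → Set₁
SSL-Sat φ = Σ Model (λ M → IsCrossAxiomModel M × Σ (Model.W M) (λ p → _⊨_ M p φ))

S4×S5-Sat : Fm → Set₁
S4×S5-Sat φ = Σ Model (λ M → IsS4S5Commutator M × Σ (Model.W M) (λ p → _⊨_ M p φ))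

-- Both directions rest on one translation lemma.  Call a map ι from the
-- points of a model M into a model N a main-embedding if it lands in the
-- m-points of N and is a bounded morphism (forth and back) for both
-- relations, the back condition only being required at m-points.  For such
-- ι, and classically, w ⊨ ψ iff ι w ⊨ T(ψ) whenever M and N agree (along ι)
-- on the variables of ψ: the guard "main ∧" in T(Kψ), T(□ψ) restricts the
-- boxes of N to exactly the images of the successors in M.
--
-- (⇒) A cross axiom model M is doubled: a copy of M where m holds, and a
--     shadow copy where no variable holds, reached by L;◇.  This is an
--     S4×S5 commutator, the copy embeds M, and T̂(φ) holds at the copy of any
--     point of φ.
-- (⇐) In an S4×S5 model with p ⊨ T̂(φ) we keep the m-points reachable from
--     p by L;◇, and the variables of φ.  The conjuncts of T̂(φ) make this a
--     cross axiom model, and the inclusion is a main-embedding.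
module Submission where

open import Defs
open import Level using (0ℓ)
open import Axiom.ExcludedMiddle using (ExcludedMiddle)
open import Axiom.DoubleNegationElimination using (DoubleNegationElimination; em⇒dne)
open import Data.Bool using (true; false) renaming (T to IsTrue)
open import Data.Empty using (⊥; ⊥-elim)
open import Data.Fin using (Fin; toℕ)
open import Data.Fin.Properties using (pigeonhole; toℕ≤pred[n])
open import Data.List using (List; length; lookup)
open import Data.List.Membership.Propositional using (_∈_)
open import Data.List.Membership.Propositional.Properties using (∈-++⁺ˡ; ∈-++⁺ʳ)
open import Data.List.NonEmpty using (List⁺; _∷_; toList; map)
open import Data.List.Relation.Unary.Any using (here; there; index)
import Data.List.Relation.Unary.Any as Any
open import Data.List.Relation.Unary.Any.Properties using (any⁺; any⁻; lookup-index)
open import Data.Nat using (ℕ; zero; suc; _+_; _≤_; z≤n)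
open import Data.Nat.Properties using (≡ᵇ⇒≡; ≡⇒≡ᵇ; n<1+n; <-irrefl; ≤-antisym; +-identityʳ; +-suc; m≤n⇒m<n∨m≡n)
open import Data.Product using (Σ-syntax; _×_; _,_; proj₁; proj₂)
open import Data.Product.Function.NonDependent.Propositional using (_×-⇔_)
open import Data.Sum using (_⊎_; inj₁; inj₂)
open import Data.Unit using (tt)
open import Function using (_∘_)
open import Function.Bundles using (_⇔_; mk⇔; Equivalence)
open import Function.Related.TypeIsomorphisms using (¬-cong-⇔)
open import Relation.Binary using (IsEquivalence)
open import Relation.Binary.PropositionalEquality using (_≡_; _≢_; refl; sym; trans; cong; subst)
open import Relation.Nullary using (¬_; yes; no)

open Equivalence using (to; from)

∈ᵇ⇔∈ : ∀ {n l} → IsTrue (n ∈ᵇ l) ⇔ n ∈ l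
∈ᵇ⇔∈ {n} {l} = mk⇔ (Any.map (λ {m} → ≡ᵇ⇒≡ n m) ∘ any⁻ _ l)
                     (any⁺ _ ∘ Any.map (λ {m} → ≡⇒≡ᵇ n m))

search-exhausts : ∀ l f k → search l f k ∈ l → ∀ j → k ≤ j → j ≤ k + f → j ∈ l
search-exhausts l zero k found j k≤j j≤k+0 =
  subst (_∈ l) (≤-antisym k≤j (subst (j ≤_) (+-identityʳ k) j≤k+0)) found
search-exhausts l (suc f) k found j k≤j j≤k+f+1 with k ∈ᵇ l in k∈ᵇl
... | false = ⊥-elim (subst IsTrue k∈ᵇl (from ∈ᵇ⇔∈ found))
... | true with m≤n⇒m<n∨m≡n k≤j
...   | inj₁ k<j = search-exhausts l f (suc k) found j k<j (subst (j ≤_) (+-suc k f) j≤k+f+1)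
...   | inj₂ refl = to ∈ᵇ⇔∈ (subst IsTrue (sym k∈ᵇl) tt)

¬covers : ∀ l → ¬ (∀ j → j ≤ length l → j ∈ l)
¬covers l covers =
  let (i , j , i<j , samePosition) = pigeonhole (n<1+n (length l)) position
  in <-irrefl (trans (entry i) (trans (cong (lookup l) samePosition) (sym (entry j)))) i<j
  where
  position : Fin (suc (length l)) → Fin (length l)
  position i = index (covers (toℕ i) (toℕ≤pred[n] i))
  entry : ∀ i → toℕ i ≡ lookup l (position i)
  entry i = lookup-index (covers (toℕ i) (toℕ≤pred[n] i))

leastNotIn-fresh : ∀ l → ¬ (leastNotIn l ∈ l)
leastNotIn-fresh l found = ¬covers l λ j → search-exhausts l (length l) 0 found j z≤n

occ : ℕ → Fm → Set
occ A φ = A ∈ toList (vars φ)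

occ-∧ˡ : ∀ {A} ψ₁ ψ₂ → occ A ψ₁ → occ A (ψ₁ ∧ ψ₂)
occ-∧ˡ _ _ = ∈-++⁺ˡ

occ-∧ʳ : ∀ {A} ψ₁ ψ₂ → occ A ψ₂ → occ A (ψ₁ ∧ ψ₂)
occ-∧ʳ ψ₁ _ = ∈-++⁺ʳ (toList (vars ψ₁))

mainVar-fresh : ∀ {A} φ → occ A φ → A ≢ mainVar φ
mainVar-fresh φ o refl = leastNotIn-fresh (toList (vars φ)) o

module Connectives (M : Model) where
  open Model M

  ⇒-intro : ∀ {p} a b → (_⊨_ M p a → _⊨_ M p b) → _⊨_ M p (a ⇒ b)
  ⇒-intro a b a→b (pa , ¬pb) = ¬pb (a→b pa)

  ⇒-elim : DoubleNegationElimination 0ℓ → ∀ {p} a b → _⊨_ M p (a ⇒ b) → _⊨_ M p a → _⊨_ M p b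
  ⇒-elim dne a b a⇒b pa = dne λ ¬pb → a⇒b (pa , ¬pb)

  ∨-introˡ : ∀ {p} a b → _⊨_ M p a → _⊨_ M p (a ∨ b)
  ∨-introˡ a b pa (¬pa , _) = ¬pa pa

  ∨-introʳ : ∀ {p} a b → _⊨_ M p b → _⊨_ M p (a ∨ b)
  ∨-introʳ a b pb (_ , ¬pb) = ¬pb pb

  ∨-elim : ExcludedMiddle 0ℓ → ∀ {p} a b → _⊨_ M p (a ∨ b) → _⊨_ M p a ⊎ _⊨_ M p b
  ∨-elim em {p} a b a∨b with em {_⊨_ M p a}
  ... | yes pa = inj₁ pa
  ... | no ¬pa = inj₂ (em⇒dne em λ ¬pb → a∨b (¬pa , ¬pb))

  bigAnd-intro : ∀ {X : Set} {p} (f : X → Fm) (xs : List⁺ X) →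
                 (∀ {x} → x ∈ toList xs → _⊨_ M p (f x)) → _⊨_ M p (bigAnd (map f xs))
  bigAnd-intro {X} {p} f (x ∷ xs) = go x xs
    where
    go : ∀ x xs → (∀ {y} → y ∈ x List.∷ xs → _⊨_ M p (f y)) → _⊨_ M p (bigAnd (map f (x ∷ xs)))
    go x List.[] each = each (here refl)
    go x (y List.∷ ys) each = each (here refl) , go y ys (each ∘ there)

  bigAnd-elim : ∀ {X : Set} {p} (f : X → Fm) (xs : List⁺ X) →
                _⊨_ M p (bigAnd (map f xs)) → ∀ {x} → x ∈ toList xs → _⊨_ M p (f x)
  bigAnd-elim {X} {p} f (x ∷ xs) = go x xs
    where
    go : ∀ x xs → _⊨_ M p (bigAnd (map f (x ∷ xs))) → ∀ {y} → y ∈ x List.∷ xs → _⊨_ M p (f y)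
    go x List.[] all (here refl) = all
    go x (y List.∷ ys) (fx , _) (here refl) = fx
    go x (y List.∷ ys) (_ , rest) (there y∈) = go y ys rest y∈

record IsLeftCommFrame (M : Model) : Set where
  open Model M
  field
    L-equiv  : IsEquivalence _⇝L_
    ◇-refl   : ∀ {x} → x ⇝◇ x
    ◇-trans  : ∀ {x y z} → x ⇝◇ y → y ⇝◇ z → x ⇝◇ z
    leftComm : LeftComm M

crossFrame : ∀ {M} → IsCrossAxiomModel M → IsLeftCommFrame M
crossFrame C = record { L-equiv = L-equiv ; ◇-refl = ◇-refl ; ◇-trans = ◇-trans ; leftComm = leftComm }
  where open IsCrossAxiomModel C

commutatorFrame : ∀ {M} → IsS4S5Commutator M → IsLeftCommFrame M
commutatorFrame C = record { L-equiv = L-equiv ; ◇-refl = ◇-refl ; ◇-trans = ◇-trans ; leftComm = leftComm }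
  where open IsS4S5Commutator C

-- In such a frame the composite L;◇ is a preorder containing L and ◇:
-- left commutativity turns ◇;L into L;◇.
module Composite {M : Model} (F : IsLeftCommFrame M) where
  open Model M
  open IsLeftCommFrame F
  module L = IsEquivalence L-equiv

  _⇝L◇_ : W → W → Set
  a ⇝L◇ b = Σ[ c ∈ W ] (a ⇝L c × c ⇝◇ b)

  L⊆L◇ : ∀ {a b} → a ⇝L b → a ⇝L◇ b
  L⊆L◇ {b = b} aLb = b , aLb , ◇-refl

  ◇⊆L◇ : ∀ {a b} → a ⇝◇ b → a ⇝L◇ b
  ◇⊆L◇ {a} a◇b = a , L.refl , a◇b

  L◇-trans : ∀ {a b c} → a ⇝L◇ b → b ⇝L◇ c → a ⇝L◇ c
  L◇-trans {b = b} (d , aLd , d◇b) (e , bLe , e◇c) =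
    let (s , dLs , s◇e) = leftComm d b e d◇b bLe
    in s , L.trans aLd dLs , ◇-trans s◇e e◇c

module _ (M N : Model) (m : ℕ) where
  private
    module M = Model M
    module N = Model N

  record MainEmbedding : Set where
    field
      ι       : M.W → N.W
      ι-main  : ∀ w → N.σ m (ι w)
      L-forth : ∀ {w v} → w M.⇝L v → ι w N.⇝L ι v
      L-back  : ∀ {w y} → ι w N.⇝L y → N.σ m y → Σ[ v ∈ M.W ] (w M.⇝L v × ι v ≡ y)
      ◇-forth : ∀ {w v} → w M.⇝◇ v → ι w N.⇝◇ ι v
      ◇-back  : ∀ {w y} → ι w N.⇝◇ y → N.σ m y → Σ[ v ∈ M.W ] (w M.⇝◇ v × ι v ≡ y)

  guarded-box : DoubleNegationElimination 0ℓ →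
    (ι : M.W → N.W) → (∀ w → N.σ m (ι w)) →
    (R : M.W → M.W → Set) (S : N.W → N.W → Set) →
    (∀ {w v} → R w v → S (ι w) (ι v)) →
    (∀ {w y} → S (ι w) y → N.σ m y → Σ[ v ∈ M.W ] (R w v × ι v ≡ y)) →
    {P : M.W → Set} {Q : N.W → Set} → (∀ v → P v ⇔ Q (ι v)) →
    ∀ w → (∀ v → R w v → P v) ⇔ (∀ y → S (ι w) y → ¬ (N.σ m y × ¬ Q y))
  guarded-box dne ι ι-main R S forth back {P} {Q} P⇔Q w = mk⇔ guard unguard
    where
    guard : (∀ v → R w v → P v) → ∀ y → S (ι w) y → ¬ (N.σ m y × ¬ Q y)
    guard boxP y wSy (my , ¬Qy) with back wSy my
    ... | v , wRv , refl = ¬Qy (to (P⇔Q v) (boxP v wRv))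
    unguard : (∀ y → S (ι w) y → ¬ (N.σ m y × ¬ Q y)) → ∀ v → R w v → P v
    unguard boxQ v wRv = from (P⇔Q v) (dne λ ¬Qv → boxQ (ι v) (forth wRv) (ι-main v , ¬Qv))

  translate : DoubleNegationElimination 0ℓ → (e : MainEmbedding) → let open MainEmbedding e in
    ∀ ψ → (∀ A → occ A ψ → ∀ w → M.σ A w ⇔ N.σ A (ι w)) →
    ∀ w → _⊨_ M w ψ ⇔ _⊨_ N (ι w) (T m ψ)
  translate dne e (var A) agree = agree A (here refl)
  translate dne e (~ ψ) agree w = ¬-cong-⇔ (translate dne e ψ agree w)
  translate dne e (ψ₁ ∧ ψ₂) agree w =
        translate dne e ψ₁ (λ A o → agree A (occ-∧ˡ ψ₁ ψ₂ o)) w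
    ×-⇔ translate dne e ψ₂ (λ A o → agree A (occ-∧ʳ ψ₁ ψ₂ o)) w
  translate dne e (K ψ) agree =
    guarded-box dne ι ι-main M._⇝L_ N._⇝L_ L-forth L-back (translate dne e ψ agree)
    where open MainEmbedding e
  translate dne e (□ ψ) agree =
    guarded-box dne ι ι-main M._⇝◇_ N._⇝◇_ ◇-forth ◇-back (translate dne e ψ agree)
    where open MainEmbedding e

module Doubling {M : Model} (C : IsCrossAxiomModel M) (m : ℕ) where
  open Model M
  open IsCrossAxiomModel C using (persistent)
  open IsLeftCommFrame (crossFrame C)
  open Composite (crossFrame C)

  base : W ⊎ W → W
  base (inj₁ a) = a
  base (inj₂ a) = a

  _⇝◇₂_ : W ⊎ W → W ⊎ W → Set
  inj₁ a ⇝◇₂ inj₁ b = a ⇝◇ b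
  inj₁ a ⇝◇₂ inj₂ b = a ⇝L◇ b
  inj₂ a ⇝◇₂ inj₁ b = ⊥
  inj₂ a ⇝◇₂ inj₂ b = a ⇝L◇ b

  σ₂ : ℕ → W ⊎ W → Set
  σ₂ A (inj₁ a) = A ≡ m ⊎ σ A a
  σ₂ A (inj₂ a) = ⊥

  doubled : Model
  doubled = record { W = W ⊎ W ; _⇝◇_ = _⇝◇₂_ ; _⇝L_ = λ x y → base x ⇝L base y ; σ = σ₂ }

  open Connectives doubled

  ◇₂⊆L◇ : ∀ x y → x ⇝◇₂ y → base x ⇝L◇ base y
  ◇₂⊆L◇ (inj₁ _) (inj₁ _) = ◇⊆L◇
  ◇₂⊆L◇ (inj₁ _) (inj₂ _) x◇y = x◇y
  ◇₂⊆L◇ (inj₂ _) (inj₂ _) x◇y = x◇y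

  copy-◇ : ∀ {a} y → a ⇝◇ base y → inj₁ a ⇝◇₂ y
  copy-◇ (inj₁ _) a◇b = a◇b
  copy-◇ (inj₂ _) a◇b = ◇⊆L◇ a◇b

  shadow-◇ : ∀ x {b} → base x ⇝L◇ b → x ⇝◇₂ inj₂ b
  shadow-◇ (inj₁ _) a⇝b = a⇝b
  shadow-◇ (inj₂ _) a⇝b = a⇝b

  ◇₂-refl : ∀ {x} → x ⇝◇₂ x
  ◇₂-refl {inj₁ _} = ◇-refl
  ◇₂-refl {inj₂ _} = ◇⊆L◇ ◇-refl

  ◇₂-trans : ∀ {x y z} → x ⇝◇₂ y → y ⇝◇₂ z → x ⇝◇₂ z
  ◇₂-trans {inj₁ _} {inj₁ _} {inj₁ _} x◇y y◇z = ◇-trans x◇y y◇z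
  ◇₂-trans {x} {y} {inj₂ _} x◇y y◇z = shadow-◇ x (L◇-trans (◇₂⊆L◇ x y x◇y) (◇₂⊆L◇ y (inj₂ _) y◇z))
  ◇₂-trans {inj₁ _} {inj₂ _} {inj₁ _} _ ()
  ◇₂-trans {inj₂ _} {inj₂ _} {inj₁ _} _ ()

  leftComm₂ : LeftComm doubled
  leftComm₂ x y z x◇y yLz =
    let (c , xLc , c◇y) = ◇₂⊆L◇ x y x◇y
        (s , cLs , s◇z) = leftComm c (base y) (base z) c◇y yLz
    in inj₁ s , L.trans xLc cLs , copy-◇ z s◇z

  rightComm₂ : RightComm doubled
  rightComm₂ x y z xLy y◇z = inj₂ (base z) , shadow-◇ x (L◇-trans (L⊆L◇ xLy) (◇₂⊆L◇ y z y◇z)) , L.refl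

  doubled-commutator : IsS4S5Commutator doubled
  doubled-commutator = record
    { L-equiv   = record { refl = L.refl ; sym = L.sym ; trans = L.trans }
    ; ◇-refl    = λ {x} → ◇₂-refl {x}
    ; ◇-trans   = λ {x} {y} {z} → ◇₂-trans {x} {y} {z}
    ; leftComm  = leftComm₂
    ; rightComm = rightComm₂ }

  -- The copy is a main-embedding: the m-points are exactly the copy.
  copy : MainEmbedding M doubled m
  copy = record
    { ι = inj₁ ; ι-main = λ _ → inj₁ refl
    ; L-forth = λ wLv → wLv ; L-back = L-back
    ; ◇-forth = λ w◇v → w◇v ; ◇-back = ◇-back }
    where
    L-back : ∀ {w y} → w ⇝L base y → σ₂ m y → Σ[ v ∈ W ] (w ⇝L v × inj₁ v ≡ y)
    L-back {y = inj₁ v} wLv _ = v , wLv , refl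
    ◇-back : ∀ {w y} → inj₁ w ⇝◇₂ y → σ₂ m y → Σ[ v ∈ W ] (w ⇝◇ v × inj₁ v ≡ y)
    ◇-back {y = inj₁ v} w◇v _ = v , w◇v , refl

  copy-agrees : ∀ {A} → A ≢ m → ∀ w → σ A w ⇔ σ₂ A (inj₁ w)
  copy-agrees A≢m w = mk⇔ inj₂ λ { (inj₁ A≡m) → ⊥-elim (A≢m A≡m) ; (inj₂ a) → a }

  -- m propagates backwards along ◇, so K□(¬m → □¬m) holds everywhere.
  m-backward : ∀ {r t} → r ⇝◇₂ t → σ₂ m t → σ₂ m r
  m-backward {inj₁ _} _ _ = inj₁ refl
  m-backward {inj₂ _} {inj₂ _} _ ()

  m-closed : ∀ x → _⊨_ doubled x (K (□ (~ var m ⇒ □ (~ var m))))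
  m-closed x y _ r _ = ⇒-intro (~ var m) (□ (~ var m)) λ ¬mr t r◇t mt → ¬mr (m-backward r◇t mt)

  shadow-vacuous : ∀ b ψ → _⊨_ doubled (inj₂ b) (var m ⇒ ψ)
  shadow-vacuous _ ψ = ⇒-intro (var m) ψ λ ()

  -- A variable A ≠ m is persistent on the copy, as it is in M; hence every
  -- point decides A uniformly on its m-points.
  persistent-A : ExcludedMiddle 0ℓ → ∀ {A} → A ≢ m → ∀ x →
                 _⊨_ doubled x (K (□ (var m ⇒ var A) ∨ □ (var m ⇒ ~ var A)))
  persistent-A em {A} A≢m _ y _ = decides y
    where
    always never : Fm
    always = □ (var m ⇒ var A)
    never  = □ (var m ⇒ ~ var A)
    decides : ∀ y → _⊨_ doubled y (always ∨ never)
    decides (inj₂ a) = ∨-introˡ {inj₂ a} always never λ { (inj₁ _) () ; (inj₂ b) _ → shadow-vacuous b (var A) }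
    decides (inj₁ v) with em {σ A v}
    ... | yes a = ∨-introˡ always never λ
      { (inj₁ u) v◇u → ⇒-intro (var m) (var A) λ _ → inj₂ (proj₁ (persistent A v u v◇u) a)
      ; (inj₂ b) _ → shadow-vacuous b (var A) }
    ... | no ¬a = ∨-introʳ always never λ
      { (inj₁ u) v◇u → ⇒-intro (var m) (~ var A) λ _ →
          λ { (inj₁ A≡m) → A≢m A≡m ; (inj₂ au) → ¬a (proj₂ (persistent A v u v◇u) au) }
      ; (inj₂ b) _ → shadow-vacuous b (~ var A) }

ssl⇒commutator : ExcludedMiddle 0ℓ → ∀ φ → SSL-Sat φ → S4×S5-Sat (That φ)
ssl⇒commutator em φ (M , C , p , p⊨φ) =
  doubled , doubled-commutator , inj₁ p ,
  inj₁ refl , m-closed (inj₁ p) ,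
  bigAnd-intro _ (vars φ) (λ o → persistent-A em (mainVar-fresh φ o) (inj₁ p)) ,
  to (translate M doubled m (em⇒dne em) copy φ (λ A o → copy-agrees (mainVar-fresh φ o)) p) p⊨φ
  where
  m : ℕ
  m = mainVar φ
  open Doubling C m
  open Connectives doubled

module Restriction {M : Model} (F : IsLeftCommFrame M) (em : ExcludedMiddle 0ℓ)
  (m : ℕ) (Relevant : ℕ → Set) (p : Model.W M)
  (m-closed : _⊨_ M p (K (□ (~ var m ⇒ □ (~ var m)))))
  (decided  : ∀ A → Relevant A → _⊨_ M p (K (□ (var m ⇒ var A) ∨ □ (var m ⇒ ~ var A))))
  where
  open Model M
  open IsLeftCommFrame F
  open Composite F
  open Connectives M

  private
    dne : DoubleNegationElimination 0ℓ
    dne = em⇒dne em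

  W₀ : Set
  W₀ = Σ[ x ∈ W ] (p ⇝L◇ x × σ m x)

  point : W₀ → W
  point = proj₁

  reached : (a : W₀) → p ⇝L◇ point a
  reached = proj₁ ∘ proj₂

  restricted : Model
  restricted = record
    { W = W₀ ; _⇝◇_ = λ a b → point a ⇝◇ point b ; _⇝L_ = λ a b → point a ⇝L point b
    ; σ = λ A a → Relevant A × σ A (point a) }

  -- Below p, m propagates backwards along ◇ (this is K□(¬m → □¬m)).
  m-backward : ∀ {x y} → p ⇝L◇ x → x ⇝◇ y → σ m y → σ m x
  m-backward {x} {y} (q , pLq , q◇x) x◇y my =
    dne λ ¬mx → ⇒-elim dne (~ var m) (□ (~ var m)) (m-closed q pLq x q◇x) ¬mx y x◇y my

  settled : ∀ {q A x y} → _⊨_ M q (□ (var m ⇒ var A) ∨ □ (var m ⇒ ~ var A)) →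
            q ⇝◇ x → q ⇝◇ y → σ m x → σ m y → σ A x → σ A y
  settled {q} {A} decides q◇x q◇y mx my ax
    with ∨-elim em {q} (□ (var m ⇒ var A)) (□ (var m ⇒ ~ var A)) decides
  ... | inj₁ always = ⇒-elim dne (var m) (var A) (always _ q◇y) my
  ... | inj₂ never  = ⊥-elim (⇒-elim dne (var m) (~ var A) (never _ q◇x) mx ax)

  leftComm₀ : LeftComm restricted
  leftComm₀ a b c a◇b bLc =
    let (s , aLs , s◇c) = leftComm (point a) (point b) (point c) a◇b bLc
        p⇝s = L◇-trans (reached a) (L⊆L◇ aLs)
    in (s , p⇝s , m-backward p⇝s s◇c (proj₂ (proj₂ c))) , aLs , s◇c

  persistent₀ : Persistent restricted
  persistent₀ A (x , (q , pLq , q◇x) , mx) (y , _ , my) x◇y =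
    (λ (r , ax) → r , settled (decided A r q pLq) q◇x q◇y mx my ax) ,
    (λ (r , ay) → r , settled (decided A r q pLq) q◇y q◇x my mx ay)
    where q◇y = ◇-trans q◇x x◇y

  restricted-cross : IsCrossAxiomModel restricted
  restricted-cross = record
    { L-equiv = record { refl = L.refl ; sym = L.sym ; trans = L.trans }
    ; ◇-refl = ◇-refl ; ◇-trans = ◇-trans
    ; leftComm = leftComm₀ ; persistent = persistent₀ }

  -- The inclusion into M is a main-embedding: the reachable set is closed
  -- under L and ◇, so every m-successor is again a point of the restriction.
  inclusion : MainEmbedding restricted M m
  inclusion = record
    { ι = point ; ι-main = proj₂ ∘ proj₂
    ; L-forth = λ aLb → aLb
    ; L-back = λ {a} {y} aLy my → (y , L◇-trans (reached a) (L⊆L◇ aLy) , my) , aLy , refl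
    ; ◇-forth = λ a◇b → a◇b
    ; ◇-back = λ {a} {y} a◇y my → (y , L◇-trans (reached a) (◇⊆L◇ a◇y) , my) , a◇y , refl }

  inclusion-agrees : ∀ {A} → Relevant A → ∀ a → (Relevant A × σ A (point a)) ⇔ σ A (point a)
  inclusion-agrees r _ = mk⇔ proj₂ (r ,_)

  root : σ m p → W₀
  root mp = p , L⊆L◇ L.refl , mp

commutator⇒ssl : ExcludedMiddle 0ℓ → ∀ φ → S4×S5-Sat (That φ) → SSL-Sat φ
commutator⇒ssl em φ (M , C , p , (mp , closed , persistentMain-p , p⊨Tφ)) =
  restricted , restricted-cross , root mp ,
  from (translate restricted M m (em⇒dne em) inclusion φ (λ A o → inclusion-agrees o) (root mp)) p⊨Tφ
  where
  m : ℕ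
  m = mainVar φ
  open Restriction (commutatorFrame C) em m (λ A → occ A φ) p closed
                   (λ A → Connectives.bigAnd-elim M _ (vars φ) persistentMain-p)

mainTheorem4 : ExcludedMiddle 0ℓ → (φ : Fm) →
    (SSL-Sat φ → S4×S5-Sat (That φ)) × (S4×S5-Sat (That φ) → SSL-Sat φ)
mainTheorem4 em φ = ssl⇒commutator em φ , commutator⇒ssl em φ
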